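{- Let $x,m,n,t$ be positive integers with $m=\prod_{i=1}^{s}p_i^{k_i}$ ($p_i$ distinct primes, $k_i\ge1$). Suppose the fraction $\frac{\sigma_x(mn)+\sigma_x(m)t}{(mn)^x}$ is in lowest terms and $I(x,p_im)>\frac{\sigma_x(mn)+\sigma_x(m)t}{(mn)^x}$ for all $1\le i\le s$. If $\frac{\sigma_x(mn)+\sigma_x(m)t}{(mn)^x}$ is an $x^{\text{th}}$ abundancy index, then $\frac{\sigma_x(n)+t}{n^x}$ is an $x^{\text{th}}$ abundancy index.
   Context: For positive integers $x,n$, $\sigma_x(n)=\sum_{d\mid n} d^x$ and $I(x,n)=\sigma_x(n)/n^x$; a rational is an $x^{\text{th}}$ abundancy index if it equals $I(x,a)$ for some positive integer $a$. -}

module Defs where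

open import Data.Nat using (ℕ; suc; _+_; _*_; _^_; NonZero)
open import Data.Nat.Properties using (m^n≢0; m*n≢0)
open import Data.Nat.Divisibility using (_∣?_)
open import Data.Nat.ListAction using (sum)
open import Data.Integer using (+_)
open import Data.Rational using (ℚ; _/_)
open import Data.List using (List; map; filter; upTo)
open import Data.Product using (∃; _×_)
open import Relation.Binary.PropositionalEquality using (_≡_)

divisors : ℕ → List ℕ
divisors n = filter (_∣? n) (map suc (upTo n))

σ : ℕ → ℕ → ℕ
σ x n = sum (map (_^ x) (divisors n))

I : (x a : ℕ) → .{{NonZero a}} → ℚ
I x a = (+ σ x a) / (a ^ x) where instance _ = m^n≢0 a x

IsAbundancyIndex : ℕ → ℚ → Set
IsAbundancyIndex x q = ∃ λ a → ∃ λ (nz : NonZero a) → I x a {{nz}} ≡ q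

numer : (x m n t : ℕ) → ℕ
numer x m n t = σ x (m * n) + σ x m * t

denom : (x m n : ℕ) → ℕ
denom x m n = (m * n) ^ x

R : (x m n t : ℕ) → .{{NonZero m}} → .{{NonZero n}} → ℚ
R x m n t = (+ numer x m n t) / denom x m n
  where instance _ = m^n≢0 (m * n) x
                 _ = m*n≢0 m n

S : (x n t : ℕ) → .{{NonZero n}} → ℚ
S x n t = (+ (σ x n + t)) / (n ^ x) where instance _ = m^n≢0 n x

module Submission where

-- Let N = σ_x(mn) + σ_x(m)t and D = (mn)^x, and suppose N/D = I(x,a).  Cross-multiplying,
-- σ_x(a)·D = N·a^x; as N/D is in lowest terms, D ∣ a^x, and since an x-th power divides an
-- x-th power only if the bases do, mn ∣ a.  Write a = c·m (so n ∣ c).  If a prime p divided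
-- both m and c, then pm ∣ a, and because the abundancy index grows along divisibility,
-- I(x,a) ≥ I(x,pm) > N/D = I(x,a), which is absurd.  Hence m is coprime to c (and to n), and
-- multiplicativity of σ_x turns the cross-multiplied equation into
--   σ_x(m)m^x · σ_x(c)n^x = σ_x(m)m^x · (σ_x(n)+t)c^x,
-- so cancelling σ_x(m)m^x ≠ 0 gives (σ_x(n)+t)/n^x = I(x,c).

open import Defs
open import Data.Nat
open import Data.Nat.Properties
open import Data.Nat.Divisibility
open _∣_ using (equality)
open import Data.Nat.Coprimality using (Coprime; coprime?; coprime-divisor; coprime-/gcd; gcd≡1⇒coprime)
import Data.Nat.Coprimality as Coprimality
open import Data.Nat.GCD using (gcd; gcd[m,n]∣m; gcd[m,n]∣n; gcd[m,n]≢0)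
open import Data.Nat.DivMod using (_/_; m*n/n≡m)
open import Data.Nat.Primality using (Prime; prime⇒nonZero)
open import Data.Nat.Primality.Factorisation using (factorise; PrimeFactorisation)
open import Data.Nat.ListAction using (sum; product)
open import Data.Nat.ListAction.Properties using (sum-++; sum-↭)
open import Data.Nat.Solver using (module +-*-Solver)
open import Data.Integer using (+_) renaming (_<_ to _<ℤ_)
import Data.Integer.Properties as ℤ
open import Data.Rational using () renaming (_/_ to _/ℚ_; _<_ to _<ℚ_)
open import Data.Rational.Properties using (normalize-injective-≃; fromℚᵘ-cong; toℚᵘ-mono-<; toℚᵘ-fromℚᵘ)
open import Data.Rational.Unnormalised using (mkℚᵘ; *≡*; *<*)
import Data.Rational.Unnormalised.Properties as ℚᵘ
open import Data.List using (List; []; _∷_; _++_; map; upTo; cartesianProduct)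
open import Data.List.Properties using (map-++; map-∘)
open import Data.List.Membership.Propositional using (_∈_)
open import Data.List.Membership.Propositional.Properties
  using (∈-∃++; ∈-++⁻; ∈-++⁺ˡ; ∈-++⁺ʳ; ∈-map⁺; ∈-map⁻; ∈-filter⁺; ∈-filter⁻; ∈-upTo⁺; ∈-cartesianProduct⁺; ∈-cartesianProduct⁻)
open import Data.List.Relation.Binary.Subset.Propositional using (_⊆_)
import Data.List.Relation.Binary.Permutation.Propositional.Properties as Perm
open import Data.List.Relation.Unary.Any using (here; there)
import Data.List.Relation.Unary.All as All
import Data.List.Relation.Unary.All.Properties as All
open import Data.List.Relation.Unary.AllPairs using ([]; _∷_)
open import Data.List.Relation.Unary.Unique.Propositional using (Unique)
import Data.List.Relation.Unary.Unique.Propositional.Properties as Unique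
open import Data.Product using (Σ; ∃₂; _×_; _,_; proj₁; proj₂; uncurry)
open import Data.Sum using (inj₁; inj₂)
open import Data.Empty using (⊥-elim)
open import Function using (_∘_)
open import Relation.Nullary using (contradiction)
open import Relation.Nullary.Decidable using (decidable-stable)
open import Relation.Binary.PropositionalEquality

sum-map-++ : ∀ {A : Set} (f : A → ℕ) (xs ys : List A) →
             sum (map f (xs ++ ys)) ≡ sum (map f xs) + sum (map f ys)
sum-map-++ f xs ys = trans (cong sum (map-++ f xs ys)) (sum-++ (map f xs) (map f ys))

-- A duplicate-free list contained in another has the smaller f-sum: each element of xs is
-- pulled out of ys, and the remaining elements of xs lie in what is left of ys.
sum-mono-⊆ : ∀ {A : Set} (f : A → ℕ) {xs ys : List A} → Unique xs → xs ⊆ ys →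
             sum (map f xs) ≤ sum (map f ys)
sum-mono-⊆ f {[]} _ _ = z≤n
sum-mono-⊆ f {x ∷ xs} (x∉xs ∷ xs!) xs⊆ys with us , vs , refl ← ∈-∃++ (xs⊆ys (here refl)) = begin
  f x + sum (map f xs)          ≤⟨ +-monoʳ-≤ (f x) (sum-mono-⊆ f xs! xs⊆us++vs) ⟩
  f x + sum (map f (us ++ vs))  ≡⟨ sum-↭ (Perm.map⁺ f (Perm.shift x us vs)) ⟨
  sum (map f (us ++ x ∷ vs))    ∎
  where
  open ≤-Reasoning
  xs⊆us++vs : xs ⊆ us ++ vs
  xs⊆us++vs y∈xs with ∈-++⁻ us (xs⊆ys (there y∈xs))
  ... | inj₁ y∈us          = ∈-++⁺ˡ y∈us
  ... | inj₂ (here refl)   = ⊥-elim (All.lookup x∉xs y∈xs refl)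
  ... | inj₂ (there y∈vs)  = ∈-++⁺ʳ us y∈vs

map-unique : ∀ {A B : Set} (g : A → B) {xs : List A} → Unique xs →
             (∀ {a b} → a ∈ xs → b ∈ xs → g a ≡ g b → a ≡ b) → Unique (map g xs)
map-unique g {[]} [] _ = []
map-unique g {x ∷ xs} (x∉xs ∷ xs!) inj =
  All.map⁺ (All.tabulate λ y∈xs gx≡gy → All.lookup x∉xs y∈xs (inj (here refl) (there y∈xs) gx≡gy))
  ∷ map-unique g xs! (λ a∈ b∈ → inj (there a∈) (there b∈))

products : List ℕ → List ℕ → List ℕ
products L M = map (uncurry _*_) (cartesianProduct L M)

module _ (f : ℕ → ℕ) (f-* : ∀ a b → f (a * b) ≡ f a * f b) where

  sum-scale : ∀ k (M : List ℕ) → sum (map f (map (k *_) M)) ≡ f k * sum (map f M)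
  sum-scale k []      = sym (*-zeroʳ (f k))
  sum-scale k (e ∷ M) = begin
    f (k * e) + sum (map f (map (k *_) M))  ≡⟨ cong₂ _+_ (f-* k e) (sum-scale k M) ⟩
    f k * f e + f k * sum (map f M)         ≡⟨ *-distribˡ-+ (f k) (f e) _ ⟨
    f k * (f e + sum (map f M))             ∎
    where open ≡-Reasoning

  sum-products : ∀ L M → sum (map f (products L M)) ≡ sum (map f L) * sum (map f M)
  sum-products []      M = refl
  sum-products (d ∷ L) M = begin
    sum (map f (products (d ∷ L) M))
      ≡⟨ cong (sum ∘ map f) (map-++ (uncurry _*_) (map (d ,_) M) (cartesianProduct L M)) ⟩
    sum (map f (map (uncurry _*_) (map (d ,_) M) ++ products L M))
      ≡⟨ sum-map-++ f (map (uncurry _*_) (map (d ,_) M)) (products L M) ⟩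
    sum (map f (map (uncurry _*_) (map (d ,_) M))) + sum (map f (products L M))
      ≡⟨ cong₂ _+_ (trans (cong (sum ∘ map f) (sym (map-∘ M))) (sum-scale d M)) (sum-products L M) ⟩
    f d * ΣM + sum (map f L) * ΣM
      ≡⟨ *-distribʳ-+ ΣM (f d) (sum (map f L)) ⟨
    (f d + sum (map f L)) * ΣM ∎
    where
    open ≡-Reasoning
    ΣM = sum (map f M)

[m*n]^k≡m^k*n^k : ∀ m n k → (m * n) ^ k ≡ m ^ k * n ^ k
[m*n]^k≡m^k*n^k m n zero    = refl
[m*n]^k≡m^k*n^k m n (suc k) = begin
  m * n * (m * n) ^ k        ≡⟨ cong (m * n *_) ([m*n]^k≡m^k*n^k m n k) ⟩
  m * n * (m ^ k * n ^ k)    ≡⟨ interchange m n (m ^ k) (n ^ k) ⟩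
  m * m ^ k * (n * n ^ k)    ∎
  where
  open ≡-Reasoning
  open +-*-Solver
  interchange : ∀ a b c d → a * b * (c * d) ≡ a * c * (b * d)
  interchange = solve 4 (λ a b c d → a :* b :* (c :* d) := a :* c :* (b :* d)) refl

∈-divisors⁺ : ∀ {n d} → .{{NonZero n}} → d ∣ n → d ∈ divisors n
∈-divisors⁺ {n} {zero}  0∣n = contradiction (0∣⇒≡0 0∣n) (≢-nonZero⁻¹ n)
∈-divisors⁺ {n} {suc d} d∣n = ∈-filter⁺ (_∣? n) (∈-map⁺ suc (∈-upTo⁺ (∣⇒≤ d∣n))) d∣n

∈-divisors⇒∣ : ∀ n {d} → d ∈ divisors n → d ∣ n
∈-divisors⇒∣ n d∈ = proj₂ (∈-filter⁻ (_∣? n) {xs = map suc (upTo n)} d∈)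

∈-divisors⇒nonZero : ∀ n {d} → d ∈ divisors n → NonZero d
∈-divisors⇒nonZero n d∈ with _ , _ , refl ← ∈-map⁻ suc (proj₁ (∈-filter⁻ (_∣? n) {xs = map suc (upTo n)} d∈)) = _

divisors-unique : ∀ n → Unique (divisors n)
divisors-unique n = Unique.filter⁺ (_∣? n) (Unique.map⁺ suc-injective (Unique.upTo⁺ n))

-- σ_x(n) ≥ 1^x = 1, since 1 ∣ n.
σ-nonZero : ∀ x n → .{{NonZero n}} → NonZero (σ x n)
σ-nonZero x n = >-nonZero (subst (_≤ σ x n) (trans (+-identityʳ (1 ^ x)) (^-zeroˡ x))
  (sum-mono-⊆ (_^ x) (All.[] ∷ []) λ { (here refl) → ∈-divisors⁺ (1∣ n) }))

-- The divisors k·e (e ∣ d) are distinct divisors of k·d, so k^x σ_x(d) ≤ σ_x(kd).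
σ-scale : ∀ x k d → .{{NonZero (k * d)}} → k ^ x * σ x d ≤ σ x (k * d)
σ-scale x k d = begin
  k ^ x * σ x d                               ≡⟨ sum-scale (_^ x) (λ a b → [m*n]^k≡m^k*n^k a b x) k (divisors d) ⟨
  sum (map (_^ x) (map (k *_) (divisors d)))  ≤⟨ sum-mono-⊆ (_^ x) k·divisors-unique k·divisors⊆ ⟩
  σ x (k * d)                                 ∎
  where
  open ≤-Reasoning
  instance _ = m*n≢0⇒m≢0 k
  k·divisors-unique : Unique (map (k *_) (divisors d))
  k·divisors-unique = map-unique (k *_) (divisors-unique d) (λ _ _ → *-cancelˡ-≡ _ _ k)
  k·divisors⊆ : map (k *_) (divisors d) ⊆ divisors (k * d)
  k·divisors⊆ y∈ with e , e∈ , refl ← ∈-map⁻ (k *_) y∈ = ∈-divisors⁺ (*-monoʳ-∣ k (∈-divisors⇒∣ d e∈))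

abundancy-mono : ∀ x {d a} → .{{NonZero a}} → d ∣ a → σ x d * a ^ x ≤ σ x a * d ^ x
abundancy-mono x {d} (divides k refl) = begin
  σ x d * (k * d) ^ x        ≡⟨ cong (σ x d *_) ([m*n]^k≡m^k*n^k k d x) ⟩
  σ x d * (k ^ x * d ^ x)    ≡⟨ *-assoc (σ x d) (k ^ x) (d ^ x) ⟨
  σ x d * k ^ x * d ^ x      ≡⟨ cong (_* d ^ x) (*-comm (σ x d) (k ^ x)) ⟩
  k ^ x * σ x d * d ^ x      ≤⟨ *-monoˡ-≤ (d ^ x) (σ-scale x k d) ⟩
  σ x (k * d) * d ^ x        ∎
  where open ≤-Reasoning

record GcdSplit (a b : ℕ) : Set where
  field
    g a′ b′  : ℕ
    g≢0      : NonZero g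
    a≡a′*g   : a ≡ a′ * g
    b≡b′*g   : b ≡ b′ * g
    coprime  : Coprime a′ b′

gcdSplit : ∀ a b → .{{NonZero b}} → GcdSplit a b
gcdSplit a b = record
  { g = g ; a′ = quotient (gcd[m,n]∣m a b) ; b′ = quotient (gcd[m,n]∣n a b) ; g≢0 = g≢0
  ; a≡a′*g = equality (gcd[m,n]∣m a b) ; b≡b′*g = equality (gcd[m,n]∣n a b)
  ; coprime = subst₂ Coprime (a/g≡quotient (gcd[m,n]∣m a b)) (a/g≡quotient (gcd[m,n]∣n a b)) (coprime-/gcd a b)
  }
  where
  g = gcd a b
  instance g≢0 : NonZero g
           g≢0 = ≢-nonZero (gcd[m,n]≢0 a b (inj₂ (≢-nonZero⁻¹ b)))
  a/g≡quotient : ∀ {c} (g∣c : g ∣ c) → c / g ≡ quotient g∣c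
  a/g≡quotient g∣c = trans (cong (_/ g) (equality g∣c)) (m*n/n≡m (quotient g∣c) g)

-- Every divisor of m·c is d·e with d ∣ m and e ∣ c (take d = gcd(f,m)).
divisor-split : ∀ {f m c} → .{{NonZero m}} → f ∣ m * c → ∃₂ λ d e → d ∣ m × e ∣ c × f ≡ d * e
divisor-split {f} {m} {c} f∣mc = g , f′ , divides m′ m≡m′*g , f′∣c , trans f≡f′*g (*-comm f′ g)
  where
  open GcdSplit (gcdSplit f m) renaming (a′ to f′; b′ to m′; a≡a′*g to f≡f′*g; b≡b′*g to m≡m′*g)
  instance _ = g≢0
  g·f′∣g·m′c : g * f′ ∣ g * (m′ * c)
  g·f′∣g·m′c = subst₂ _∣_ (trans f≡f′*g (*-comm f′ g))
    (trans (cong (_* c) (trans m≡m′*g (*-comm m′ g))) (*-assoc g m′ c)) f∣mc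
  f′∣c : f′ ∣ c
  f′∣c = coprime-divisor coprime (*-cancelˡ-∣ g g·f′∣g·m′c)

coprime-factors-unique : ∀ {m c d e d′ e′} → Coprime m c → NonZero d →
  d ∣ m → d′ ∣ m → e ∣ c → e′ ∣ c → d * e ≡ d′ * e′ → d ≡ d′ × e ≡ e′
coprime-factors-unique {m} {c} {d} {e} {d′} {e′} cop d≢0 d∣m d′∣m e∣c e′∣c de≡d′e′ = d≡d′ , e≡e′
  where
  coprime-within : ∀ {u v} → u ∣ m → v ∣ c → Coprime u v
  coprime-within u∣m v∣c (i∣u , i∣v) = cop (∣-trans i∣u u∣m , ∣-trans i∣v v∣c)
  d≡d′ : d ≡ d′
  d≡d′ = ∣-antisym
    (coprime-divisor (coprime-within d∣m e′∣c) (subst (d ∣_) (trans de≡d′e′ (*-comm d′ e′)) (m∣m*n e)))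
    (coprime-divisor (coprime-within d′∣m e∣c) (subst (d′ ∣_) (trans (sym de≡d′e′) (*-comm d e)) (m∣m*n e′)))
  e≡e′ : e ≡ e′
  e≡e′ = *-cancelˡ-≡ e e′ d {{d≢0}} (trans de≡d′e′ (cong (_* e′) (sym d≡d′)))

-- σ_x is multiplicative: for coprime m, c the divisors of m·c are exactly the distinct
-- products of a divisor of m and a divisor of c.
σ-multiplicative : ∀ x m c → .{{NonZero m}} → .{{NonZero c}} → Coprime m c → σ x (m * c) ≡ σ x m * σ x c
σ-multiplicative x m c cop = ≤-antisym
  (subst (σ x (m * c) ≤_) Σproducts (sum-mono-⊆ (_^ x) (divisors-unique (m * c)) divisors⊆products))
  (subst (_≤ σ x (m * c)) Σproducts (sum-mono-⊆ (_^ x) products-unique products⊆divisors))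
  where
  instance _ = m*n≢0 m c
  L = divisors m
  M = divisors c
  Σproducts : sum (map (_^ x) (products L M)) ≡ σ x m * σ x c
  Σproducts = sum-products (_^ x) (λ a b → [m*n]^k≡m^k*n^k a b x) L M
  divisors⊆products : divisors (m * c) ⊆ products L M
  divisors⊆products y∈ with d , e , d∣m , e∣c , refl ← divisor-split (∈-divisors⇒∣ (m * c) y∈) =
    ∈-map⁺ (uncurry _*_) (∈-cartesianProduct⁺ (∈-divisors⁺ d∣m) (∈-divisors⁺ e∣c))
  products⊆divisors : products L M ⊆ divisors (m * c)
  products⊆divisors y∈ with (d , e) , de∈ , refl ← ∈-map⁻ (uncurry _*_) y∈
                       with d∈ , e∈ ← ∈-cartesianProduct⁻ L M de∈ =
    ∈-divisors⁺ (*-pres-∣ (∈-divisors⇒∣ m d∈) (∈-divisors⇒∣ c e∈))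
  products-unique : Unique (products L M)
  products-unique = map-unique (uncurry _*_)
    (Unique.cartesianProduct⁺ (divisors-unique m) (divisors-unique c)) pair-injective
    where
    pair-injective : ∀ {p q} → p ∈ cartesianProduct L M → q ∈ cartesianProduct L M →
                     uncurry _*_ p ≡ uncurry _*_ q → p ≡ q
    pair-injective p∈ q∈ de≡d′e′
      with d∈ , e∈ ← ∈-cartesianProduct⁻ L M p∈ | d′∈ , e′∈ ← ∈-cartesianProduct⁻ L M q∈
      with refl , refl ← coprime-factors-unique cop (∈-divisors⇒nonZero m d∈)
             (∈-divisors⇒∣ m d∈) (∈-divisors⇒∣ m d′∈) (∈-divisors⇒∣ c e∈) (∈-divisors⇒∣ c e′∈) de≡d′e′ = refl

coprime-∣-^ : ∀ {a b} k → Coprime a b → a ∣ b ^ k → a ∣ 1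
coprime-∣-^ zero    cop a∣1     = a∣1
coprime-∣-^ (suc k) cop a∣b^1+k = coprime-∣-^ k cop (coprime-divisor cop a∣b^1+k)

-- x-th powers can be cancelled from divisibility: with u = u′g, v = v′g and u′, v′ coprime,
-- u′^x ∣ v′^x forces u′ = 1.
^-cancel-∣ : ∀ x {u v} → .{{NonZero x}} → .{{NonZero u}} → u ^ x ∣ v ^ x → u ∣ v
^-cancel-∣ x@(suc x′) {u} {v} u^x∣v^x = subst (_∣ v) (sym u≡g) (divides v′ v≡v′*g)
  where
  open GcdSplit (gcdSplit v u) renaming (a′ to v′; b′ to u′; a≡a′*g to v≡v′*g; b≡b′*g to u≡u′*g)
  instance _ = g≢0
           _ = m^n≢0 g x
  g^x·u′^x∣g^x·v′^x : g ^ x * u′ ^ x ∣ g ^ x * v′ ^ x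
  g^x·u′^x∣g^x·v′^x = subst₂ _∣_
    (trans (cong (_^ x) (trans u≡u′*g (*-comm u′ g))) ([m*n]^k≡m^k*n^k g u′ x))
    (trans (cong (_^ x) (trans v≡v′*g (*-comm v′ g))) ([m*n]^k≡m^k*n^k g v′ x)) u^x∣v^x
  u′≡1 : u′ ≡ 1
  u′≡1 = ∣1⇒≡1 (coprime-∣-^ x (Coprimality.sym coprime)
    (∣-trans (m∣m*n (u′ ^ x′)) (*-cancelˡ-∣ (g ^ x) g^x·u′^x∣g^x·v′^x)))
  u≡g : u ≡ g
  u≡g = trans u≡u′*g (trans (cong (_* g) u′≡1) (*-identityˡ g))

prime-factor : ∀ g → .{{NonZero g}} → g ≢ 1 → Σ ℕ λ p → Prime p × p ∣ g
prime-factor g g≢1 with PrimeFactorisation.factors (factorise g)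
                      | PrimeFactorisation.isFactorisation (factorise g)
                      | PrimeFactorisation.factorsPrime (factorise g)
... | []     | g≡Π | _      = contradiction g≡Π g≢1
... | p ∷ ps | g≡Π | pp All.∷ _ = p , pp , subst (p ∣_) (sym g≡Π) (m∣m*n (product ps))

/-≡⇒cross : ∀ a b c d → .{{_ : NonZero b}} → .{{_ : NonZero d}} → (+ a) /ℚ b ≡ (+ c) /ℚ d → a * d ≡ c * b
/-≡⇒cross a b c d = normalize-injective-≃ a c b d {{≢-nonZero (≢-nonZero⁻¹ b)}} {{≢-nonZero (≢-nonZero⁻¹ d)}}

cross⇒/-≡ : ∀ a b c d → .{{_ : NonZero b}} → .{{_ : NonZero d}} → a * d ≡ c * b → (+ a) /ℚ b ≡ (+ c) /ℚ d
cross⇒/-≡ a (suc b) c (suc d) ad≡cb = fromℚᵘ-cong {mkℚᵘ (+ a) b} {mkℚᵘ (+ c) d}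
  (*≡* (trans (sym (ℤ.pos-* a (suc d))) (trans (cong +_ ad≡cb) (ℤ.pos-* c (suc b)))))

/-<⇒cross : ∀ a b c d → .{{_ : NonZero b}} → .{{_ : NonZero d}} → (+ a) /ℚ b <ℚ (+ c) /ℚ d → a * d < c * b
/-<⇒cross a (suc b) c (suc d) a/b<c/d
  with *<* ad<cb ← ℚᵘ.<-respʳ-≃ (toℚᵘ-fromℚᵘ (mkℚᵘ (+ c) d))
                     (ℚᵘ.<-respˡ-≃ (toℚᵘ-fromℚᵘ (mkℚᵘ (+ a) b)) (toℚᵘ-mono-< a/b<c/d)) =
  ℤ.drop‿+<+ (subst₂ _<ℤ_ (sym (ℤ.pos-* a (suc d))) (sym (ℤ.pos-* c (suc b))) ad<cb)

lowest-terms-denominator-∣ : ∀ {a b c d} → .{{_ : NonZero b}} → .{{_ : NonZero d}} →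
  Coprime c d → (+ a) /ℚ b ≡ (+ c) /ℚ d → d ∣ b
lowest-terms-denominator-∣ {a} {b} {c} {d} cop a/b≡c/d =
  coprime-divisor (Coprimality.sym cop) (divides a (sym (/-≡⇒cross a b c d a/b≡c/d)))

-- If I(x,a) < I(x,pm) for every prime p ∣ m, then m is coprime to the cofactor a/m: a common
-- prime p would give pm ∣ a and hence I(x,pm) ≤ I(x,a).
cofactor-coprime : ∀ x m a → .{{_ : NonZero m}} → .{{_ : NonZero a}} → (m∣a : m ∣ a) →
  ((p : ℕ) (pp : Prime p) → p ∣ m → I x a <ℚ I x (p * m) {{m*n≢0 p m {{prime⇒nonZero pp}}}}) →
  Coprime m (quotient m∣a)
cofactor-coprime x m a m∣a@(divides c a≡c*m) below = decidable-stable (coprime? m c) λ ¬cop →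
  let instance _ = ≢-nonZero (gcd[m,n]≢0 m c (inj₂ (≢-nonZero⁻¹ c {{quotient≢0 m∣a}})))
      p , pp , p∣gcd = prime-factor (gcd m c) (¬cop ∘ gcd≡1⇒coprime)
      instance _ = prime⇒nonZero pp
               _ = m*n≢0 p m
      pm∣a : p * m ∣ a
      pm∣a = subst (p * m ∣_) (sym a≡c*m) (*-monoˡ-∣ m (∣-trans p∣gcd (gcd[m,n]∣n m c)))
  in <⇒≱ (/-<⇒cross (σ x a) (a ^ x) (σ x (p * m)) ((p * m) ^ x) {{m^n≢0 a x}} {{m^n≢0 (p * m) x}}
            (below p pp (∣-trans p∣gcd (gcd[m,n]∣m m c))))
         (abundancy-mono x pm∣a)

-- With a = c·m and m coprime to c and n, the cross-multiplied equation R = I(x,a) becomes,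
-- after cancelling σ_x(m)m^x, the cross-multiplied equation S = I(x,c).
cross-transfer : ∀ x m n t c → .{{_ : NonZero m}} → .{{_ : NonZero n}} → .{{_ : NonZero c}} →
  Coprime m c → Coprime m n →
  σ x (c * m) * denom x m n ≡ numer x m n t * (c * m) ^ x →
  σ x c * n ^ x ≡ (σ x n + t) * c ^ x
cross-transfer x m n t c cop-mc cop-mn cross = *-cancelˡ-≡ _ _ K {{K≢0}} (begin
  K * (σ x c * n ^ x)                          ≡⟨ rearrange₁ (σ x m) (m ^ x) (σ x c) (n ^ x) ⟩
  σ x c * σ x m * (m ^ x * n ^ x)              ≡⟨ cong₂ _*_ (σ-multiplicative x c m (Coprimality.sym cop-mc))
                                                            ([m*n]^k≡m^k*n^k m n x) ⟨
  σ x (c * m) * (m * n) ^ x                    ≡⟨ cross ⟩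
  (σ x (m * n) + σ x m * t) * (c * m) ^ x      ≡⟨ cong₂ (λ s p → (s + σ x m * t) * p)
                                                        (σ-multiplicative x m n cop-mn) ([m*n]^k≡m^k*n^k c m x) ⟩
  (σ x m * σ x n + σ x m * t) * (c ^ x * m ^ x) ≡⟨ rearrange₂ (σ x m) (m ^ x) (σ x n) t (c ^ x) ⟩
  K * ((σ x n + t) * c ^ x)                    ∎)
  where
  open ≡-Reasoning
  open +-*-Solver
  K = σ x m * m ^ x
  K≢0 : NonZero K
  K≢0 = m*n≢0 (σ x m) (m ^ x) {{σ-nonZero x m}} {{m^n≢0 m x}}
  rearrange₁ : ∀ s M σc N → s * M * (σc * N) ≡ σc * s * (M * N)
  rearrange₁ = solve 4 (λ s M σc N → s :* M :* (σc :* N) := σc :* s :* (M :* N)) refl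
  rearrange₂ : ∀ s M σn t C → (s * σn + s * t) * (C * M) ≡ s * M * ((σn + t) * C)
  rearrange₂ = solve 5 (λ s M σn t C → (s :* σn :+ s :* t) :* (C :* M) := s :* M :* ((σn :+ t) :* C)) refl

mainTheorem15 : (x m n t : ℕ) → .{{_ : NonZero x}} → .{{_ : NonZero m}} → .{{_ : NonZero n}} → .{{_ : NonZero t}}
    → Coprime (numer x m n t) (denom x m n)
    → ((p : ℕ) → (pp : Prime p) → p ∣ m → R x m n t <ℚ I x (p * m) {{m*n≢0 p m {{prime⇒nonZero pp}}}})
    → IsAbundancyIndex x (R x m n t)
    → IsAbundancyIndex x (S x n t)
mainTheorem15 x m n t lowest below (a , a≢0 , Ia≡R) =
  c , c≢0 , cross⇒/-≡ (σ x c) (c ^ x) (σ x n + t) (n ^ x) {{m^n≢0 c x}} {{m^n≢0 n x}}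
            (cross-transfer x m n t c cop-mc cop-mn cross)
  where
  instance _ = a≢0
           _ = m*n≢0 m n
  -- (mn)^x ∣ a^x as R is in lowest terms, hence mn ∣ a
  mn∣a : m * n ∣ a
  mn∣a = ^-cancel-∣ x (lowest-terms-denominator-∣ {σ x a} {a ^ x} {numer x m n t} {denom x m n} {{m^n≢0 a x}} {{m^n≢0 (m * n) x}} lowest Ia≡R)
  q = quotient mn∣a
  c = q * n
  a≡c*m : a ≡ c * m
  a≡c*m = trans (equality mn∣a) (trans (cong (q *_) (*-comm m n)) (sym (*-assoc q n m)))
  m∣a : m ∣ a
  m∣a = divides c a≡c*m
  c≢0 : NonZero c
  c≢0 = quotient≢0 m∣a
  instance _ = c≢0
  cop-mc : Coprime m c
  cop-mc = cofactor-coprime x m a m∣a (λ p pp p∣m → subst (_<ℚ _) (sym Ia≡R) (below p pp p∣m))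
  cop-mn : Coprime m n
  cop-mn (i∣m , i∣n) = cop-mc (i∣m , ∣-trans i∣n (n∣m*n q))
  cross : σ x (c * m) * denom x m n ≡ numer x m n t * (c * m) ^ x
  cross = subst (λ b → σ x b * denom x m n ≡ numer x m n t * b ^ x) a≡c*m
    (/-≡⇒cross (σ x a) (a ^ x) (numer x m n t) (denom x m n) {{m^n≢0 a x}} {{m^n≢0 (m * n) x}} Ia≡R)
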